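{- Let $S_x=(0:\zeta_p^i:1)$ be a cusp with Zariski closure $\mathcal{S}_x$ in $\mathfrak{F}_p$, let $\mathcal{C}_x=(2g-2)(\mathcal{S}_x+\mathcal{F}_x)$ be the canonical divisor with $\mathcal{F}_x=\frac{1}{2g-2}(\mathcal{V}_x+\mathcal{V}_\Sigma)$, and let $\mathcal{D}_x=\mathcal{S}_x+\mathcal{G}_x$ with $\mathcal{G}_x=\frac1pL_x$. Then, for intersection numbers in the fibre above $(\pi)$, $$\mathcal{F}_x\cdot\mathcal{F}_x=-\frac{p^3-7p^2+15p-8}{p^2(p-3)^2},\qquad \mathcal{S}_x\cdot\mathcal{G}_x=-(\mathcal{G}_x\cdot\mathcal{G}_x)=\frac1p.$$
   Context: $p>3$ prime, $\zeta_p$ a primitive $p$-th root of unity, $\pi=1-\zeta_p$. $F_p$: $X^p+Y^p=Z^p$ over $\mathbb{Q}(\zeta_p)$, genus $g=(p-1)(p-2)/2$. $\mathfrak{F}_p$ is McCallum's regular model of $F_p$ over $\operatorname{Spec}\mathbb{Z}[\zeta_p]$. Its fibre above $(\pi)$ consists (geometrically) of genus-0 components: $L$ (multiplicity $p$, self-intersection $-1$); $L_x,L_y,L_z$ (multiplicity 1, self-intersection $-p$); $L_{\beta_1},\dots,L_{\beta_s}$ (multiplicity 1, self-intersection $-p$); $L_{\alpha_1},\dots,L_{\alpha_r}$ (multiplicity 2, self-intersection $-p$); for each $i$, $L_{\alpha_{i,1}},\dots,L_{\alpha_{i,p}}$ (multiplicity 1, self-intersection $-2$) each meeting $L_{\alpha_i}$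 once; $L$ meets each of $L_x,L_y,L_z,L_{\alpha_i},L_{\beta_j}$ once and there are no other intersections; $2r+s=p-3$. The closure $\mathcal{S}_x$ meets this fibre only in $L_x$, with intersection number 1. $\mathcal{V}_x=\lambda_xL_x+\lambda_yL_y+\lambda_zL_z$ and $\mathcal{V}_\Sigma=\sum_{i=1}^r(\sum_{j=1}^p\lambda_{\alpha_{i,j}}L_{\alpha_{i,j}}+\lambda_{\alpha_i}L_{\alpha_i})+\sum_{i=1}^s\lambda_{\beta_i}L_{\beta_i}$ with $\lambda_x=\frac{2g-p}{p}$, $\lambda_y=\lambda_z=\lambda_{\beta_i}=\lambda_{\alpha_{j,k}}=-\frac{p-2}{p}$, $\lambda_{\alpha_j}=-2\frac{p-2}{p}$; then $(2g-2)\mathcal{S}_x+\mathcal{V}_x+\mathcal{V}_\Sigma$ is a canonical divisor of $\mathfrak{F}_p$. -}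

module Defs where

open import Data.Nat as ℕ using (ℕ; suc; zero; _∸_)
open import Data.Nat.DivMod using () renaming (_/_ to _div_)
open import Data.Integer as ℤ using (ℤ; +_)
open import Data.Rational as ℚ using (ℚ; 0ℚ; 1ℚ; _+_; _*_; -_)
open import Data.Fin using (Fin)
open import Data.Fin.Properties using (_≟_)
open import Data.List using (List; _∷_; []; map; concatMap; foldr; _++_)
open import Data.List.Base using (allFin)
open import Data.Bool using (if_then_else_)
open import Relation.Nullary.Decidable using (⌊_⌋)

-- Totalised fraction n/d (only ever used with d ≠ 0).
ratio : ℤ → ℕ → ℚ
ratio n zero = 0ℚ
ratio n (suc d) = ℚ._/_ n (suc d)

-- Geometric components of the fibre of McCallum's model above (π).
data Comp (p r s : ℕ) : Set where
  L Lx Ly Lz : Comp p r s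
  Lβ : Fin s → Comp p r s
  Lα : Fin r → Comp p r s
  Lαj : Fin r → Fin p → Comp p r s

allComps : (p r s : ℕ) → List (Comp p r s)
allComps p r s = L ∷ Lx ∷ Ly ∷ Lz ∷ (map Lβ (allFin s) ++ (map Lα (allFin r)
  ++ concatMap (λ i → map (Lαj i) (allFin p)) (allFin r)))

-- intersection numbers of fibre components
int : {p r s : ℕ} → Comp p r s → Comp p r s → ℤ
int L L = ℤ.-[1+ 0 ]
int {p} Lx Lx = ℤ.- (+ p)
int {p} Ly Ly = ℤ.- (+ p)
int {p} Lz Lz = ℤ.- (+ p)
int {p} (Lβ i) (Lβ j) = if ⌊ i ≟ j ⌋ then ℤ.- (+ p) else + 0
int {p} (Lα i) (Lα j) = if ⌊ i ≟ j ⌋ then ℤ.- (+ p) else + 0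
int (Lαj i k) (Lαj i' k') = if ⌊ i ≟ i' ⌋ then (if ⌊ k ≟ k' ⌋ then ℤ.-[1+ 1 ] else + 0) else + 0
int L Lx = + 1
int L Ly = + 1
int L Lz = + 1
int L (Lβ _) = + 1
int L (Lα _) = + 1
int Lx L = + 1
int Ly L = + 1
int Lz L = + 1
int (Lβ _) L = + 1
int (Lα _) L = + 1
int (Lα i) (Lαj i' _) = if ⌊ i ≟ i' ⌋ then + 1 else + 0
int (Lαj i' _) (Lα i) = if ⌊ i ≟ i' ⌋ then + 1 else + 0
int _ _ = + 0

-- intersection of the horizontal divisor 𝒮_x with fibre components
intS : {p r s : ℕ} → Comp p r s → ℤ
intS Lx = + 1
intS _ = + 0

-- ℚ-divisors supported on the fibre above (π)
VDiv : (p r s : ℕ) → Set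
VDiv p r s = Comp p r s → ℚ

sumℚ : {A : Set} → List A → (A → ℚ) → ℚ
sumℚ xs f = foldr (λ x acc → f x + acc) 0ℚ xs

_·_ : {p r s : ℕ} → VDiv p r s → VDiv p r s → ℚ
_·_ {p} {r} {s} D E = sumℚ (allComps p r s) λ c → sumℚ (allComps p r s) λ c' →
  D c * (E c' * (ℚ._/_ (int c c') 1))

S·_ : {p r s : ℕ} → VDiv p r s → ℚ
S·_ {p} {r} {s} D = sumℚ (allComps p r s) λ c → D c * (ℚ._/_ (intS c) 1)

genus : ℕ → ℕ
genus p = ((p ∸ 1) ℕ.* (p ∸ 2)) div 2

-- λ-coefficients of 𝒱_x + 𝒱_Σ
λcoef : {p r s : ℕ} → Comp p r s → ℚ
λcoef {p} L = 0ℚ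
λcoef {p} Lx = ratio (+ (2 ℕ.* genus p) ℤ.- + p) p
λcoef {p} Ly = - ratio (+ (p ∸ 2)) p
λcoef {p} Lz = - ratio (+ (p ∸ 2)) p
λcoef {p} (Lβ _) = - ratio (+ (p ∸ 2)) p
λcoef {p} (Lαj _ _) = - ratio (+ (p ∸ 2)) p
λcoef {p} (Lα _) = - ratio (+ (2 ℕ.* (p ∸ 2))) p

Fx : (p r s : ℕ) → VDiv p r s
Fx p r s c = ratio (+ 1) (2 ℕ.* genus p ∸ 2) * λcoef c

Gx : (p r s : ℕ) → VDiv p r s
Gx p r s Lx = ratio (+ 1) p
Gx p r s _ = 0ℚ

module Submission where

-- Every vertical divisor occurring in the theorem is symmetric: its coefficient on L_β
-- does not depend on β, and likewise for the L_α and the L_{α,j}.  Such a divisor is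
-- described by a Shape (seven rationals), and the intersection pairing restricted to
-- symmetric divisors becomes an explicit quadratic form in the shape coefficients.
--
-- It then shows that the intersection matrix maps
-- symmetric divisors to symmetric divisors (row-symmetric), giving the pairing of two
-- shapes; for the "canonical" shape (0 on L, x on L_x, y on the other reduced components,
-- 2y on the L_α) the self-intersection is -p (x² + (2 + s + 2r) y²).  Both 𝓕_x and 𝒢_x
-- have canonical shape.  Substituting the coefficients of 𝓕_x (with 2g - 2 = p(p - 3)
-- and 2r + s = p - 3) turns its self-intersection into a polynomial identity in p, and
-- 𝒢_x = (1/p) L_x gives 𝒢_x · 𝒢_x = -1/p, while 𝒮_x · D only sees the coefficient of L_x.

open import Defs
open import Data.Nat as ℕ using (ℕ; suc; zero; _<_; _∸_; _^_; s≤s)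
import Data.Nat.Properties as ℕₚ
open import Data.Nat.DivMod using (_/_; m*n/n≡m)
import Data.Nat.Tactic.RingSolver as ℕ-Solver
open import Data.Nat.Primality using (Prime)
open import Data.Integer as ℤ using (ℤ; +_)
open import Data.Integer.Properties using (pos-+; pos-*)
import Data.Integer.Tactic.RingSolver as ℤ-Solver
open import Data.Rational as ℚ using (ℚ; 0ℚ; 1ℚ; _+_; _*_; -_; toℚᵘ)
open import Data.Rational.Properties
import Data.Rational.Unnormalised as ℚᵘ
import Data.Rational.Unnormalised.Properties as ℚᵘₚ
open import Data.Fin using (Fin)
import Data.Fin.Properties as Finₚ
open import Data.List using (List; []; _∷_; _++_; map; concatMap; length; allFin)
open import Data.List.Properties using (length-tabulate; map-tabulate)
open import Data.Bool using (if_then_else_)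
open import Data.Product using (_×_; _,_)
open import Function using (_∘_; id)
open import Level using (0ℓ)
open import Relation.Nullary.Decidable using (⌊_⌋; dec⇒maybe; isYes≗does; dec-true; dec-false)
open import Relation.Binary.PropositionalEquality
import Tactic.RingSolver as Solver
open import Algebra.Properties.Group +-0-group using (⁻¹-involutive)
import Tactic.RingSolver.Core.AlmostCommutativeRing as ACR

ℚ-ring : ACR.AlmostCommutativeRing 0ℓ 0ℓ
ℚ-ring = ACR.fromCommutativeRing +-*-commutativeRing (λ x → dec⇒maybe (0ℚ ≟ x))

-- The integer z as a rational number; this is how Defs turns intersection numbers into rationals.
ι : ℤ → ℚ
ι z = z ℚ./ 1

ιₙ : ℕ → ℚ
ιₙ n = ι (+ n)

toℚᵘ-ι : ∀ z → toℚᵘ (ι z) ℚᵘ.≃ ℚᵘ.mkℚᵘ z 0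
toℚᵘ-ι z = toℚᵘ-fromℚᵘ (ℚᵘ.mkℚᵘ z 0)

module _ where
  open ℚᵘₚ.≃-Reasoning

  ι-+ : ∀ x y → ι (x ℤ.+ y) ≡ ι x + ι y
  ι-+ x y = toℚᵘ-injective (begin
    toℚᵘ (ι (x ℤ.+ y))          ≈⟨ toℚᵘ-ι _ ⟩
    ℚᵘ.mkℚᵘ (x ℤ.+ y) 0         ≈⟨ ℚᵘ.*≡* (lemma x y) ⟩
    ℚᵘ.mkℚᵘ x 0 ℚᵘ.+ ℚᵘ.mkℚᵘ y 0 ≈⟨ ℚᵘₚ.+-cong (ℚᵘₚ.≃-sym (toℚᵘ-ι x)) (ℚᵘₚ.≃-sym (toℚᵘ-ι y)) ⟩
    toℚᵘ (ι x) ℚᵘ.+ toℚᵘ (ι y)    ≈⟨ ℚᵘₚ.≃-sym (toℚᵘ-homo-+ (ι x) (ι y)) ⟩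
    toℚᵘ (ι x + ι y)            ∎)
    where lemma : ∀ x y → (x ℤ.+ y) ℤ.* + 1 ≡ (x ℤ.* + 1 ℤ.+ y ℤ.* + 1) ℤ.* + 1
          lemma = ℤ-Solver.solve-∀

  ι-* : ∀ x y → ι (x ℤ.* y) ≡ ι x * ι y
  ι-* x y = toℚᵘ-injective (begin
    toℚᵘ (ι (x ℤ.* y))          ≈⟨ toℚᵘ-ι _ ⟩
    ℚᵘ.mkℚᵘ (x ℤ.* y) 0         ≈⟨ ℚᵘ.*≡* refl ⟩
    ℚᵘ.mkℚᵘ x 0 ℚᵘ.* ℚᵘ.mkℚᵘ y 0 ≈⟨ ℚᵘₚ.*-cong (ℚᵘₚ.≃-sym (toℚᵘ-ι x)) (ℚᵘₚ.≃-sym (toℚᵘ-ι y)) ⟩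
    toℚᵘ (ι x) ℚᵘ.* toℚᵘ (ι y)    ≈⟨ ℚᵘₚ.≃-sym (toℚᵘ-homo-* (ι x) (ι y)) ⟩
    toℚᵘ (ι x * ι y)            ∎)

  ι-neg : ∀ x → ι (ℤ.- x) ≡ - ι x
  ι-neg x = toℚᵘ-injective (begin
    toℚᵘ (ι (ℤ.- x))     ≈⟨ toℚᵘ-ι _ ⟩
    ℚᵘ.- ℚᵘ.mkℚᵘ x 0     ≈⟨ ℚᵘₚ.-‿cong (ℚᵘₚ.≃-sym (toℚᵘ-ι x)) ⟩
    ℚᵘ.- toℚᵘ (ι x)      ≈⟨ ℚᵘₚ.≃-sym (toℚᵘ-homo‿- (ι x)) ⟩
    toℚᵘ (- ι x)         ∎)

  ratio-mul : ∀ z d → ratio z (suc d) * ιₙ (suc d) ≡ ι z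
  ratio-mul z d = toℚᵘ-injective (begin
    toℚᵘ (ratio z (suc d) * ιₙ (suc d))              ≈⟨ toℚᵘ-homo-* (ratio z (suc d)) (ιₙ (suc d)) ⟩
    toℚᵘ (ratio z (suc d)) ℚᵘ.* toℚᵘ (ιₙ (suc d))    ≈⟨ ℚᵘₚ.*-cong (toℚᵘ-fromℚᵘ (ℚᵘ.mkℚᵘ z d)) (toℚᵘ-ι _) ⟩
    ℚᵘ.mkℚᵘ z d ℚᵘ.* ℚᵘ.mkℚᵘ (+ suc d) 0             ≈⟨ ℚᵘ.*≡* (lemma z (+ suc d)) ⟩
    ℚᵘ.mkℚᵘ z 0                                      ≈⟨ ℚᵘₚ.≃-sym (toℚᵘ-ι z) ⟩
    toℚᵘ (ι z)                                       ∎)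
    where lemma : ∀ z n → (z ℤ.* n) ℤ.* + 1 ≡ z ℤ.* (n ℤ.* + 1)
          lemma = ℤ-Solver.solve-∀

ι-− : ∀ x y → ι (x ℤ.- y) ≡ ι x + - ι y
ι-− x y = trans (ι-+ x (ℤ.- y)) (cong (_+_ (ι x)) (ι-neg y))

ιₙ-+ : ∀ m n → ιₙ (m ℕ.+ n) ≡ ιₙ m + ιₙ n
ιₙ-+ m n = trans (cong ι (pos-+ m n)) (ι-+ (+ m) (+ n))

ιₙ-* : ∀ m n → ιₙ (m ℕ.* n) ≡ ιₙ m * ιₙ n
ιₙ-* m n = trans (cong ι (pos-* m n)) (ι-* (+ m) (+ n))

div-by : ∀ {x y u v} → u * v ≡ 1ℚ → x * v ≡ y → x ≡ y * u
div-by {x} {y} {u} {v} uv≡1 xv≡y = begin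
  x             ≡⟨ sym (*-identityʳ x) ⟩
  x * 1ℚ        ≡⟨ cong (x *_) (sym uv≡1) ⟩
  x * (u * v)   ≡⟨ regroup x u v ⟩
  (x * v) * u   ≡⟨ cong (_* u) xv≡y ⟩
  y * u         ∎
  where
  open ≡-Reasoning
  regroup : ∀ x u v → x * (u * v) ≡ (x * v) * u
  regroup = Solver.solve-∀ ℚ-ring

ratio-factor : ∀ z d → ratio z (suc d) ≡ ι z * ratio (+ 1) (suc d)
ratio-factor z d = div-by (ratio-mul (+ 1) d) (ratio-mul z d)

module _ {A : Set} where

  sum-cong : ∀ (xs : List A) {f g : A → ℚ} → (∀ x → f x ≡ g x) → sumℚ xs f ≡ sumℚ xs g
  sum-cong []       f≗g = refl
  sum-cong (x ∷ xs) f≗g = cong₂ _+_ (f≗g x) (sum-cong xs f≗g)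

  sum-++ : ∀ (xs ys : List A) f → sumℚ (xs ++ ys) f ≡ sumℚ xs f + sumℚ ys f
  sum-++ []       ys f = sym (+-identityˡ _)
  sum-++ (x ∷ xs) ys f = trans (cong (_+_ (f x)) (sum-++ xs ys f)) (sym (+-assoc (f x) _ _))

  sum-*ˡ : ∀ (xs : List A) a f → sumℚ xs (λ x → a * f x) ≡ a * sumℚ xs f
  sum-*ˡ []       a f = sym (*-zeroʳ a)
  sum-*ˡ (x ∷ xs) a f = trans (cong (_+_ (a * f x)) (sum-*ˡ xs a f)) (sym (*-distribˡ-+ a (f x) _))

  sum-*ʳ : ∀ (xs : List A) a f → sumℚ xs (λ x → f x * a) ≡ sumℚ xs f * a
  sum-*ʳ []       a f = sym (*-zeroˡ a)
  sum-*ʳ (x ∷ xs) a f = trans (cong (_+_ (f x * a)) (sum-*ʳ xs a f)) (sym (*-distribʳ-+ a (f x) _))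

  sum-zero : ∀ (xs : List A) {f} → (∀ x → f x ≡ 0ℚ) → sumℚ xs f ≡ 0ℚ
  sum-zero []       f≗0 = refl
  sum-zero (x ∷ xs) f≗0 = trans (cong₂ _+_ (f≗0 x) (sum-zero xs f≗0)) (+-identityˡ 0ℚ)

  sum-const : ∀ (xs : List A) {f v} → (∀ x → f x ≡ v) → sumℚ xs f ≡ ιₙ (length xs) * v
  sum-const []       {v = v} f≗v = sym (*-zeroˡ v)
  sum-const (x ∷ xs) {v = v} f≗v = begin
    _                         ≡⟨ cong₂ _+_ (f≗v x) (sum-const xs f≗v) ⟩
    v + ιₙ (length xs) * v    ≡⟨ count v (ιₙ (length xs)) ⟩
    (1ℚ + ιₙ (length xs)) * v ≡⟨ cong (_* v) (sym (ιₙ-+ 1 (length xs))) ⟩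
    ιₙ (suc (length xs)) * v  ∎
    where
    open ≡-Reasoning
    count : ∀ v n → v + n * v ≡ (1ℚ + n) * v
    count = Solver.solve-∀ ℚ-ring

module _ {A B : Set} where

  sum-map : ∀ (g : A → B) (xs : List A) f → sumℚ (map g xs) f ≡ sumℚ xs (f ∘ g)
  sum-map g []       f = refl
  sum-map g (x ∷ xs) f = cong (_+_ (f (g x))) (sum-map g xs f)

  sum-concatMap : ∀ (g : A → List B) (xs : List A) f →
    sumℚ (concatMap g xs) f ≡ sumℚ xs (λ x → sumℚ (g x) f)
  sum-concatMap g []       f = refl
  sum-concatMap g (x ∷ xs) f =
    trans (sum-++ (g x) _ f) (cong (_+_ (sumℚ (g x) f)) (sum-concatMap g xs f))

sum-const-Fin : ∀ n {f : Fin n → ℚ} {v} → (∀ i → f i ≡ v) → sumℚ (allFin n) f ≡ ιₙ n * v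
sum-const-Fin n {v = v} f≗v =
  trans (sum-const (allFin n) f≗v) (cong (λ m → ιₙ m * v) (length-tabulate {n = n} id))

sum-Fin-suc : ∀ n (f : Fin (suc n) → ℚ) → sumℚ (allFin (suc n)) f ≡ f Fin.zero + sumℚ (allFin n) (f ∘ Fin.suc)
sum-Fin-suc n f = cong (_+_ (f Fin.zero))
  (trans (cong (λ xs → sumℚ xs f) (sym (map-tabulate id Fin.suc))) (sum-map Fin.suc (allFin n) f))

sum-δ : ∀ n (i : Fin n) (f : Fin n → ℚ) → (∀ j → j ≢ i → f j ≡ 0ℚ) → sumℚ (allFin n) f ≡ f i
sum-δ (suc n) Fin.zero f off-i = begin
  sumℚ (allFin (suc n)) f                   ≡⟨ sum-Fin-suc n f ⟩
  f Fin.zero + sumℚ (allFin n) (f ∘ Fin.suc) ≡⟨ cong (_+_ (f Fin.zero)) (sum-zero (allFin n) (λ j → off-i (Fin.suc j) λ ())) ⟩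
  f Fin.zero + 0ℚ                           ≡⟨ +-identityʳ _ ⟩
  f Fin.zero                                ∎
  where open ≡-Reasoning
sum-δ (suc n) (Fin.suc i) f off-i = begin
  sumℚ (allFin (suc n)) f                   ≡⟨ sum-Fin-suc n f ⟩
  f Fin.zero + sumℚ (allFin n) (f ∘ Fin.suc) ≡⟨ cong₂ _+_ (off-i Fin.zero λ ()) (sum-δ n i (f ∘ Fin.suc) off-i′) ⟩
  0ℚ + f (Fin.suc i)                         ≡⟨ +-identityˡ _ ⟩
  f (Fin.suc i)                              ∎
  where
  open ≡-Reasoning
  off-i′ : ∀ j → j ≢ i → f (Fin.suc j) ≡ 0ℚ
  off-i′ j j≢i = off-i (Fin.suc j) (j≢i ∘ Finₚ.suc-injective)

δ-one : ∀ {n} x (i : Fin n) v → x * ι (if ⌊ i Finₚ.≟ i ⌋ then v else + 0) ≡ x * ι v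
δ-one x i v = cong (λ b → x * ι (if b then v else + 0))
  (trans (isYes≗does (i Finₚ.≟ i)) (dec-true (i Finₚ.≟ i) refl))

δ-zero : ∀ {n} x {i j : Fin n} v → i ≢ j → x * ι (if ⌊ i Finₚ.≟ j ⌋ then v else + 0) ≡ 0ℚ
δ-zero x {i} {j} v i≢j = trans (cong (λ b → x * ι (if b then v else + 0))
  (trans (isYes≗does (i Finₚ.≟ j)) (dec-false (i Finₚ.≟ j) i≢j))) (*-zeroʳ x)

sum-δ-if : ∀ n (i : Fin n) (f : Fin n → ℚ) v →
  sumℚ (allFin n) (λ j → f j * ι (if ⌊ i Finₚ.≟ j ⌋ then v else + 0)) ≡ f i * ι v
sum-δ-if n i f v = trans (sum-δ n i _ (λ j j≢i → δ-zero (f j) v (j≢i ∘ sym))) (δ-one (f i) i v)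

sum-δ-if′ : ∀ n (i : Fin n) (f : Fin n → ℚ) v →
  sumℚ (allFin n) (λ j → f j * ι (if ⌊ j Finₚ.≟ i ⌋ then v else + 0)) ≡ f i * ι v
sum-δ-if′ n i f v = trans (sum-δ n i _ (λ j j≢i → δ-zero (f j) v j≢i)) (δ-one (f i) i v)

record Shape : Set where
  constructor shape
  field cL cx cy cz cβ cα cαj : ℚ
open Shape

⟦_⟧ : ∀ {p r s} → Shape → VDiv p r s
⟦ σ ⟧ L         = cL σ
⟦ σ ⟧ Lx        = cx σ
⟦ σ ⟧ Ly        = cy σ
⟦ σ ⟧ Lz        = cz σ
⟦ σ ⟧ (Lβ _)    = cβ σ
⟦ σ ⟧ (Lα _)    = cα σ
⟦ σ ⟧ (Lαj _ _) = cαj σ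

_⊙_ : Shape → Shape → Shape
σ ⊙ τ = shape (cL σ * cL τ) (cx σ * cx τ) (cy σ * cy τ) (cz σ * cz τ)
              (cβ σ * cβ τ) (cα σ * cα τ) (cαj σ * cαj τ)

⊙-symmetric : ∀ {p r s} {f g : VDiv p r s} {σ τ} → f ≗ ⟦ σ ⟧ → g ≗ ⟦ τ ⟧ → (λ c → f c * g c) ≗ ⟦ σ ⊙ τ ⟧
⊙-symmetric {σ = σ} {τ} f≗σ g≗τ c = trans (cong₂ _*_ (f≗σ c) (g≗τ c)) (⟦⊙⟧ c)
  where
  ⟦⊙⟧ : ∀ c → ⟦ σ ⟧ c * ⟦ τ ⟧ c ≡ ⟦ σ ⊙ τ ⟧ c
  ⟦⊙⟧ L         = refl
  ⟦⊙⟧ Lx        = refl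
  ⟦⊙⟧ Ly        = refl
  ⟦⊙⟧ Lz        = refl
  ⟦⊙⟧ (Lβ _)    = refl
  ⟦⊙⟧ (Lα _)    = refl
  ⟦⊙⟧ (Lαj _ _) = refl

module Fibre (p r s : ℕ) where

  Component : Set
  Component = Comp p r s

  all : List Component
  all = allComps p r s

  sum-fibre : ∀ (f : VDiv p r s) {l lx ly lz b a j} →
    f L ≡ l → f Lx ≡ lx → f Ly ≡ ly → f Lz ≡ lz →
    sumℚ (allFin s) (f ∘ Lβ) ≡ b → sumℚ (allFin r) (f ∘ Lα) ≡ a →
    sumℚ (allFin r) (λ i → sumℚ (allFin p) (f ∘ Lαj i)) ≡ j →
    sumℚ all f ≡ l + (lx + (ly + (lz + (b + (a + j)))))
  sum-fibre f eL eX eY eZ eβ eα eαj =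
    cong₂ _+_ eL (cong₂ _+_ eX (cong₂ _+_ eY (cong₂ _+_ eZ (begin
      sumℚ (map Lβ (allFin s) ++ (map Lα (allFin r) ++ concatMap αj-row (allFin r))) f
        ≡⟨ sum-++ (map Lβ (allFin s)) _ f ⟩
      sumℚ (map Lβ (allFin s)) f + sumℚ (map Lα (allFin r) ++ concatMap αj-row (allFin r)) f
        ≡⟨ cong₂ _+_ (sum-map Lβ (allFin s) f) (sum-++ (map Lα (allFin r)) _ f) ⟩
      sumℚ (allFin s) (f ∘ Lβ) + (sumℚ (map Lα (allFin r)) f + sumℚ (concatMap αj-row (allFin r)) f)
        ≡⟨ cong₂ _+_ eβ (cong₂ _+_ (trans (sum-map Lα (allFin r) f) eα) (trans αj-sum eαj)) ⟩
      _ ∎))))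
    where
    open ≡-Reasoning
    αj-row : Fin r → List Component
    αj-row i = map (Lαj i) (allFin p)
    αj-sum : sumℚ (concatMap αj-row (allFin r)) f ≡ sumℚ (allFin r) (λ i → sumℚ (allFin p) (f ∘ Lαj i))
    αj-sum = trans (sum-concatMap αj-row (allFin r) f)
                   (sum-cong (allFin r) (λ i → sum-map (Lαj i) (allFin p) f))

  total : Shape → ℚ
  total σ = cL σ + (cx σ + (cy σ + (cz σ + (ιₙ s * cβ σ + (ιₙ r * cα σ + ιₙ r * (ιₙ p * cαj σ))))))

  sum-symmetric : ∀ {f : VDiv p r s} {σ} → f ≗ ⟦ σ ⟧ → sumℚ all f ≡ total σ
  sum-symmetric {f} f≗σ = sum-fibre f (f≗σ L) (f≗σ Lx) (f≗σ Ly) (f≗σ Lz)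
    (sum-const-Fin s (f≗σ ∘ Lβ)) (sum-const-Fin r (f≗σ ∘ Lα))
    (sum-const-Fin r (λ i → sum-const-Fin p (f≗σ ∘ Lαj i)))

  weighted : VDiv p r s → Component → VDiv p r s
  weighted E c c′ = E c′ * ι (int c c′)

  row : VDiv p r s → Component → ℚ
  row E c = sumℚ all (weighted E c)

  ·-by-rows : ∀ (D E : VDiv p r s) → D · E ≡ sumℚ all (λ c → D c * row E c)
  ·-by-rows D E = sum-cong all (λ c → sum-*ˡ all (D c) (λ c′ → E c′ * ι (int c c′)))

  -- The intersection matrix maps symmetric divisors to symmetric divisors; this is its action
  -- on shapes (L meets everything but the L_{α,j}; L_α meets its p components L_{α,j}).
  intersect : Shape → Shape
  intersect σ = shape
    (cL σ * - 1ℚ + (cx σ + (cy σ + (cz σ + (ιₙ s * cβ σ + ιₙ r * cα σ)))))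
    (cL σ + cx σ * - ιₙ p)
    (cL σ + cy σ * - ιₙ p)
    (cL σ + cz σ * - ιₙ p)
    (cL σ + cβ σ * - ιₙ p)
    (cL σ + (cα σ * - ιₙ p + ιₙ p * cαj σ))
    (cα σ + cαj σ * - ιₙ 2)

  row-L : ∀ {E σ} → E ≗ ⟦ σ ⟧ → row E L ≡ cL (intersect σ)
  row-L {E} {σ} E≗σ = trans (sum-symmetric (⊙-symmetric E≗σ int-L))
    (tidy (cL σ) (cx σ) (cy σ) (cz σ) (cβ σ) (cα σ) (cαj σ) (ιₙ s) (ιₙ r) (ιₙ p))
    where
    int-L : (λ c → ι (int L c)) ≗ ⟦ shape (- 1ℚ) 1ℚ 1ℚ 1ℚ 1ℚ 1ℚ 0ℚ ⟧
    int-L L = refl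
    int-L Lx = refl
    int-L Ly = refl
    int-L Lz = refl
    int-L (Lβ _) = refl
    int-L (Lα _) = refl
    int-L (Lαj _ _) = refl
    tidy : ∀ a x y z b c d S R q →
      a * - 1ℚ + (x * 1ℚ + (y * 1ℚ + (z * 1ℚ + (S * (b * 1ℚ) + (R * (c * 1ℚ) + R * (q * (d * 0ℚ)))))))
        ≡ a * - 1ℚ + (x + (y + (z + (S * b + R * c))))
    tidy = Solver.solve-∀ ℚ-ring

  row-Lx : ∀ {E σ} → E ≗ ⟦ σ ⟧ → row E Lx ≡ cx (intersect σ)
  row-Lx {E} {σ} E≗σ = trans (sum-symmetric (⊙-symmetric E≗σ int-Lx))
    (trans (tidy (cL σ) (cx σ) (ι (ℤ.- (+ p))) (cy σ) (cz σ) (cβ σ) (cα σ) (cαj σ) (ιₙ s) (ιₙ r) (ιₙ p))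
           (cong (λ m → cL σ + cx σ * m) (ι-neg (+ p))))
    where
    int-Lx : (λ c → ι (int Lx c)) ≗ ⟦ shape 1ℚ (ι (ℤ.- (+ p))) 0ℚ 0ℚ 0ℚ 0ℚ 0ℚ ⟧
    int-Lx L = refl
    int-Lx Lx = refl
    int-Lx Ly = refl
    int-Lx Lz = refl
    int-Lx (Lβ _) = refl
    int-Lx (Lα _) = refl
    int-Lx (Lαj _ _) = refl
    tidy : ∀ a x m u v b c d S R q →
      a * 1ℚ + (x * m + (u * 0ℚ + (v * 0ℚ + (S * (b * 0ℚ) + (R * (c * 0ℚ) + R * (q * (d * 0ℚ))))))) ≡ a + x * m
    tidy = Solver.solve-∀ ℚ-ring

  row-Ly : ∀ {E σ} → E ≗ ⟦ σ ⟧ → row E Ly ≡ cy (intersect σ)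
  row-Ly {E} {σ} E≗σ = trans (sum-symmetric (⊙-symmetric E≗σ int-Ly))
    (trans (tidy (cL σ) (cy σ) (ι (ℤ.- (+ p))) (cx σ) (cz σ) (cβ σ) (cα σ) (cαj σ) (ιₙ s) (ιₙ r) (ιₙ p))
           (cong (λ m → cL σ + cy σ * m) (ι-neg (+ p))))
    where
    int-Ly : (λ c → ι (int Ly c)) ≗ ⟦ shape 1ℚ 0ℚ (ι (ℤ.- (+ p))) 0ℚ 0ℚ 0ℚ 0ℚ ⟧
    int-Ly L = refl
    int-Ly Lx = refl
    int-Ly Ly = refl
    int-Ly Lz = refl
    int-Ly (Lβ _) = refl
    int-Ly (Lα _) = refl
    int-Ly (Lαj _ _) = refl
    tidy : ∀ a x m u v b c d S R q →
      a * 1ℚ + (u * 0ℚ + (x * m + (v * 0ℚ + (S * (b * 0ℚ) + (R * (c * 0ℚ) + R * (q * (d * 0ℚ))))))) ≡ a + x * m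
    tidy = Solver.solve-∀ ℚ-ring

  row-Lz : ∀ {E σ} → E ≗ ⟦ σ ⟧ → row E Lz ≡ cz (intersect σ)
  row-Lz {E} {σ} E≗σ = trans (sum-symmetric (⊙-symmetric E≗σ int-Lz))
    (trans (tidy (cL σ) (cz σ) (ι (ℤ.- (+ p))) (cx σ) (cy σ) (cβ σ) (cα σ) (cαj σ) (ιₙ s) (ιₙ r) (ιₙ p))
           (cong (λ m → cL σ + cz σ * m) (ι-neg (+ p))))
    where
    int-Lz : (λ c → ι (int Lz c)) ≗ ⟦ shape 1ℚ 0ℚ 0ℚ (ι (ℤ.- (+ p))) 0ℚ 0ℚ 0ℚ ⟧
    int-Lz L = refl
    int-Lz Lx = refl
    int-Lz Ly = refl
    int-Lz Lz = refl
    int-Lz (Lβ _) = refl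
    int-Lz (Lα _) = refl
    int-Lz (Lαj _ _) = refl
    tidy : ∀ a x m u v b c d S R q →
      a * 1ℚ + (u * 0ℚ + (v * 0ℚ + (x * m + (S * (b * 0ℚ) + (R * (c * 0ℚ) + R * (q * (d * 0ℚ))))))) ≡ a + x * m
    tidy = Solver.solve-∀ ℚ-ring

  row-Lβ : ∀ {E σ} → E ≗ ⟦ σ ⟧ → ∀ i → row E (Lβ i) ≡ cβ (intersect σ)
  row-Lβ {E} {σ} E≗σ i = trans
    (sum-fibre (weighted E (Lβ i)) (cong (_* 1ℚ) (E≗σ L)) (*-zeroʳ (E Lx)) (*-zeroʳ (E Ly)) (*-zeroʳ (E Lz))
      (trans (sum-δ-if s i (E ∘ Lβ) (ℤ.- (+ p))) (cong₂ _*_ (E≗σ (Lβ i)) (ι-neg (+ p))))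
      (sum-zero (allFin r) (λ k → *-zeroʳ (E (Lα k))))
      (sum-zero (allFin r) (λ i′ → sum-zero (allFin p) (λ k → *-zeroʳ (E (Lαj i′ k))))))
    (tidy (cL σ) (cβ σ) (- ιₙ p))
    where
    tidy : ∀ a b m → a * 1ℚ + (0ℚ + (0ℚ + (0ℚ + (b * m + (0ℚ + 0ℚ))))) ≡ a + b * m
    tidy = Solver.solve-∀ ℚ-ring

  row-Lα : ∀ {E σ} → E ≗ ⟦ σ ⟧ → ∀ i → row E (Lα i) ≡ cα (intersect σ)
  row-Lα {E} {σ} E≗σ i = trans
    (sum-fibre (weighted E (Lα i)) (cong (_* 1ℚ) (E≗σ L)) (*-zeroʳ (E Lx)) (*-zeroʳ (E Ly)) (*-zeroʳ (E Lz))
      (sum-zero (allFin s) (λ k → *-zeroʳ (E (Lβ k))))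
      (trans (sum-δ-if r i (E ∘ Lα) (ℤ.- (+ p))) (cong₂ _*_ (E≗σ (Lα i)) (ι-neg (+ p))))
      αj-neighbours)
    (tidy (cL σ) (cα σ) (- ιₙ p) (ιₙ p * cαj σ))
    where
    αj-neighbours : sumℚ (allFin r) (λ i′ → sumℚ (allFin p) (weighted E (Lα i) ∘ Lαj i′))
                      ≡ (ιₙ p * cαj σ) * 1ℚ
    αj-neighbours = begin
      _ ≡⟨ sum-cong (allFin r) (λ i′ → sum-*ʳ (allFin p) (ι (if ⌊ i Finₚ.≟ i′ ⌋ then + 1 else + 0)) (E ∘ Lαj i′)) ⟩
      sumℚ (allFin r) (λ i′ → sumℚ (allFin p) (E ∘ Lαj i′) * ι (if ⌊ i Finₚ.≟ i′ ⌋ then + 1 else + 0))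
        ≡⟨ sum-δ-if r i (λ i′ → sumℚ (allFin p) (E ∘ Lαj i′)) (+ 1) ⟩
      sumℚ (allFin p) (E ∘ Lαj i) * 1ℚ ≡⟨ cong (_* 1ℚ) (sum-const-Fin p (E≗σ ∘ Lαj i)) ⟩
      (ιₙ p * cαj σ) * 1ℚ ∎
      where open ≡-Reasoning
    tidy : ∀ a c m n → a * 1ℚ + (0ℚ + (0ℚ + (0ℚ + (0ℚ + (c * m + n * 1ℚ))))) ≡ a + (c * m + n)
    tidy = Solver.solve-∀ ℚ-ring

  row-Lαj : ∀ {E σ} → E ≗ ⟦ σ ⟧ → ∀ i j → row E (Lαj i j) ≡ cαj (intersect σ)
  row-Lαj {E} {σ} E≗σ i j = trans
    (sum-fibre (weighted E (Lαj i j)) (*-zeroʳ (E L)) (*-zeroʳ (E Lx)) (*-zeroʳ (E Ly)) (*-zeroʳ (E Lz))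
      (sum-zero (allFin s) (λ k → *-zeroʳ (E (Lβ k))))
      (trans (sum-δ-if′ r i (E ∘ Lα) (+ 1)) (cong (_* 1ℚ) (E≗σ (Lα i))))
      αj-neighbours)
    (tidy (cα σ) (cαj σ) (- ιₙ 2))
    where
    αj-neighbours : sumℚ (allFin r) (λ i′ → sumℚ (allFin p) (weighted E (Lαj i j) ∘ Lαj i′))
                      ≡ cαj σ * - ιₙ 2
    αj-neighbours = begin
      _ ≡⟨ sum-δ r i (λ i′ → sumℚ (allFin p) (weighted E (Lαj i j) ∘ Lαj i′)) off-i ⟩
      sumℚ (allFin p) (weighted E (Lαj i j) ∘ Lαj i)
        ≡⟨ sum-cong (allFin p) (λ k → δ-one (E (Lαj i k)) i _) ⟩
      sumℚ (allFin p) (λ k → E (Lαj i k) * ι (if ⌊ j Finₚ.≟ k ⌋ then ℤ.-[1+ 1 ] else + 0))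
        ≡⟨ sum-δ-if p j (E ∘ Lαj i) ℤ.-[1+ 1 ] ⟩
      E (Lαj i j) * - ιₙ 2 ≡⟨ cong (_* - ιₙ 2) (E≗σ (Lαj i j)) ⟩
      cαj σ * - ιₙ 2 ∎
      where
      open ≡-Reasoning
      off-i : ∀ i′ → i′ ≢ i → sumℚ (allFin p) (weighted E (Lαj i j) ∘ Lαj i′) ≡ 0ℚ
      off-i i′ i′≢i = sum-zero (allFin p) (λ k → δ-zero (E (Lαj i′ k)) _ (i′≢i ∘ sym))
    tidy : ∀ c d m → 0ℚ + (0ℚ + (0ℚ + (0ℚ + (0ℚ + (c * 1ℚ + d * m))))) ≡ c + d * m
    tidy = Solver.solve-∀ ℚ-ring

  row-symmetric : ∀ {E σ} → E ≗ ⟦ σ ⟧ → row E ≗ ⟦ intersect σ ⟧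
  row-symmetric E≗σ L         = row-L E≗σ
  row-symmetric E≗σ Lx        = row-Lx E≗σ
  row-symmetric E≗σ Ly        = row-Ly E≗σ
  row-symmetric E≗σ Lz        = row-Lz E≗σ
  row-symmetric E≗σ (Lβ i)    = row-Lβ E≗σ i
  row-symmetric E≗σ (Lα i)    = row-Lα E≗σ i
  row-symmetric E≗σ (Lαj i j) = row-Lαj E≗σ i j

  pairing : ∀ {D E : VDiv p r s} {σ τ} → D ≗ ⟦ σ ⟧ → E ≗ ⟦ τ ⟧ → D · E ≡ total (σ ⊙ intersect τ)
  pairing {D} {E} D≗σ E≗τ = trans (·-by-rows D E) (sum-symmetric (⊙-symmetric D≗σ (row-symmetric E≗τ)))

  canonical : ℚ → ℚ → Shape
  canonical x y = shape 0ℚ x y y y (ιₙ 2 * y) y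

  -- Its self-intersection; 2 + s + 2r counts the components L_y, L_z, L_β and (twice) L_α.
  canonical-self-intersection : ∀ {D : VDiv p r s} x y → D ≗ ⟦ canonical x y ⟧ →
    D · D ≡ - (ιₙ p * (x * x + (ιₙ 2 + (ιₙ 2 * ιₙ r + ιₙ s)) * (y * y)))
  canonical-self-intersection x y D≗σ = trans (pairing D≗σ D≗σ) (expand x y (ιₙ p) (ιₙ s) (ιₙ r))
    where
    expand : ∀ x y q S R →
      0ℚ * (0ℚ * - 1ℚ + (x + (y + (y + (S * y + R * (ιₙ 2 * y)))))) +
      (x * (0ℚ + x * - q) + (y * (0ℚ + y * - q) + (y * (0ℚ + y * - q) +
      (S * (y * (0ℚ + y * - q)) + (R * ((ιₙ 2 * y) * (0ℚ + ((ιₙ 2 * y) * - q + q * y))) +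
      R * (q * (y * (ιₙ 2 * y + y * - ιₙ 2))))))))
        ≡ - (q * (x * x + (ιₙ 2 + (ιₙ 2 * R + S)) * (y * y)))
    expand = Solver.solve-∀ ℚ-ring

  S·-picks-Lx : ∀ (D : VDiv p r s) → S· D ≡ D Lx
  S·-picks-Lx D = trans
    (sum-fibre (λ c → D c * ι (intS c)) (*-zeroʳ (D L)) (*-identityʳ (D Lx)) (*-zeroʳ (D Ly)) (*-zeroʳ (D Lz))
      (sum-zero (allFin s) (λ k → *-zeroʳ (D (Lβ k))))
      (sum-zero (allFin r) (λ k → *-zeroʳ (D (Lα k))))
      (sum-zero (allFin r) (λ i → sum-zero (allFin p) (λ k → *-zeroʳ (D (Lαj i k))))))
    (tidy (D Lx))
    where
    tidy : ∀ x → 0ℚ + (x + (0ℚ + (0ℚ + (0ℚ + (0ℚ + 0ℚ))))) ≡ x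
    tidy = Solver.solve-∀ ℚ-ring

triangle : ℕ → ℕ
triangle zero    = 0
triangle (suc n) = suc n ℕ.+ triangle n

consecutive-product : ∀ n → suc n ℕ.* n ≡ triangle n ℕ.* 2
consecutive-product zero    = refl
consecutive-product (suc n) = begin
  suc (suc n) ℕ.* suc n                 ≡⟨ expand n ⟩
  suc n ℕ.* 2 ℕ.+ suc n ℕ.* n           ≡⟨ cong (suc n ℕ.* 2 ℕ.+_) (consecutive-product n) ⟩
  suc n ℕ.* 2 ℕ.+ triangle n ℕ.* 2      ≡⟨ ℕₚ.*-distribʳ-+ 2 (suc n) (triangle n) ⟨
  (suc n ℕ.+ triangle n) ℕ.* 2          ∎
  where
  open ≡-Reasoning
  expand : ∀ n → suc (suc n) ℕ.* suc n ≡ suc n ℕ.* 2 ℕ.+ suc n ℕ.* n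
  expand = ℕ-Solver.solve-∀

twice-genus : ∀ n → 2 ℕ.* genus (2 ℕ.+ n) ≡ suc n ℕ.* n
twice-genus n = begin
  2 ℕ.* ((suc n ℕ.* n) / 2)        ≡⟨ cong (λ m → 2 ℕ.* (m / 2)) (consecutive-product n) ⟩
  2 ℕ.* ((triangle n ℕ.* 2) / 2)   ≡⟨ cong (2 ℕ.*_) (m*n/n≡m (triangle n) 2) ⟩
  2 ℕ.* triangle n                 ≡⟨ ℕₚ.*-comm 2 (triangle n) ⟩
  triangle n ℕ.* 2                 ≡⟨ consecutive-product n ⟨
  suc n ℕ.* n                      ∎
  where open ≡-Reasoning

ιₙ-square : ∀ n → ιₙ (n ^ 2) ≡ ιₙ n * ιₙ n
ιₙ-square n = trans (ιₙ-* n (n ^ 1)) (cong (ιₙ n *_) (cong ιₙ (ℕₚ.*-identityʳ n)))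

ιₙ-cube : ∀ n → ιₙ (n ^ 3) ≡ ιₙ n * (ιₙ n * ιₙ n)
ιₙ-cube n = trans (ιₙ-* n (n ^ 2)) (cong (ιₙ n *_) (ιₙ-square n))

ratio-scale : ∀ a b d → ratio (+ (a ℕ.* b)) (suc d) ≡ ιₙ a * ratio (+ b) (suc d)
ratio-scale a b d = begin
  ratio (+ (a ℕ.* b)) (suc d)        ≡⟨ ratio-factor (+ (a ℕ.* b)) d ⟩
  ιₙ (a ℕ.* b) * ratio (+ 1) (suc d) ≡⟨ cong (_* ratio (+ 1) (suc d)) (ιₙ-* a b) ⟩
  (ιₙ a * ιₙ b) * ratio (+ 1) (suc d) ≡⟨ *-assoc (ιₙ a) (ιₙ b) _ ⟩
  ιₙ a * (ιₙ b * ratio (+ 1) (suc d)) ≡⟨ cong (ιₙ a *_) (ratio-factor (+ b) d) ⟨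
  ιₙ a * ratio (+ b) (suc d)         ∎
  where open ≡-Reasoning

-- The rational function behind F_x·F_x, written in τ = p - 4: with u = 1/p and
-- x = k(2g - p)/p, y = -k(p - 2)/p, one has p(x² + (p - 1)y²) = k² (p³ - 7p² + 15p - 8).
self-intersection-value : ∀ {q x y c n} τ k u →
  q ≡ ιₙ 4 + τ →
  x ≡ k * (((ιₙ 3 + τ) * (ιₙ 2 + τ) + - q) * u) →
  y ≡ k * - ((ιₙ 2 + τ) * u) →
  c ≡ ιₙ 2 + (1ℚ + τ) →
  n ≡ q * (q * q) + - (ιₙ 7 * (q * q)) + ιₙ 15 * q + - ιₙ 8 →
  u * q ≡ 1ℚ →
  - (q * (x * x + c * (y * y))) ≡ - (n * (k * k))
self-intersection-value {q} {n = n} τ k u refl refl refl refl refl uq≡1 = begin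
  _                                        ≡⟨ polynomial τ k u ⟩
  - (n * (k * k)) * ((u * q) * (u * q))    ≡⟨ cong (λ w → - (n * (k * k)) * (w * w)) uq≡1 ⟩
  - (n * (k * k)) * 1ℚ                     ≡⟨ *-identityʳ _ ⟩
  - (n * (k * k))                          ∎
  where
  open ≡-Reasoning
  polynomial : ∀ τ k u → let q = ιₙ 4 + τ in
    - (q * ((k * (((ιₙ 3 + τ) * (ιₙ 2 + τ) + - q) * u)) * (k * (((ιₙ 3 + τ) * (ιₙ 2 + τ) + - q) * u))
            + (ιₙ 2 + (1ℚ + τ)) * ((k * - ((ιₙ 2 + τ) * u)) * (k * - ((ιₙ 2 + τ) * u)))))
      ≡ - ((q * (q * q) + - (ιₙ 7 * (q * q)) + ιₙ 15 * q + - ιₙ 8) * (k * k)) * ((u * q) * (u * q))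
  polynomial = Solver.solve-∀ ℚ-ring

module FxCoefficients (t r s : ℕ) where

  P : ℕ
  P = 4 ℕ.+ t

  open Fibre P r s

  τ u k : ℚ
  τ = ιₙ t
  u = ratio (+ 1) P
  k = ratio (+ 1) (2 ℕ.* genus P ∸ 2)

  canonical-degree : 2 ℕ.* genus P ∸ 2 ≡ P ℕ.* suc t
  canonical-degree = begin
    2 ℕ.* genus P ∸ 2                ≡⟨ cong (_∸ 2) (trans (twice-genus (2 ℕ.+ t)) (shift t)) ⟩
    2 ℕ.+ P ℕ.* suc t ∸ 2            ≡⟨ ℕₚ.m+n∸m≡n 2 _ ⟩
    P ℕ.* suc t                      ∎
    where
    open ≡-Reasoning
    shift : ∀ t → (3 ℕ.+ t) ℕ.* (2 ℕ.+ t) ≡ 2 ℕ.+ (4 ℕ.+ t) ℕ.* suc t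
    shift = ℕ-Solver.solve-∀

  k-inverse : k * ιₙ (P ℕ.* suc t) ≡ 1ℚ
  k-inverse = trans (cong (λ n → ratio (+ 1) n * ιₙ (P ℕ.* suc t)) canonical-degree) (ratio-mul (+ 1) (ℕ.pred (P ℕ.* suc t)))

  Fx-canonical : Fx P r s ≗ ⟦ canonical (Fx P r s Lx) (Fx P r s Ly) ⟧
  Fx-canonical L         = *-zeroʳ k
  Fx-canonical Lx        = refl
  Fx-canonical Ly        = refl
  Fx-canonical Lz        = refl
  Fx-canonical (Lβ _)    = refl
  Fx-canonical (Lα _)    = begin
    k * - ratio (+ (2 ℕ.* (2 ℕ.+ t))) P    ≡⟨ cong (λ w → k * - w) (ratio-scale 2 (2 ℕ.+ t) (3 ℕ.+ t)) ⟩
    k * - (ιₙ 2 * ratio (+ (2 ℕ.+ t)) P)   ≡⟨ pull-out k (ιₙ 2) (ratio (+ (2 ℕ.+ t)) P) ⟩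
    ιₙ 2 * (k * - ratio (+ (2 ℕ.+ t)) P)   ∎
    where
    open ≡-Reasoning
    pull-out : ∀ k a w → k * - (a * w) ≡ a * (k * - w)
    pull-out = Solver.solve-∀ ℚ-ring
  Fx-canonical (Lαj _ _) = refl

  x-value : Fx P r s Lx ≡ k * (((ιₙ 3 + τ) * (ιₙ 2 + τ) + - ιₙ P) * u)
  x-value = cong (k *_) (trans (ratio-factor (+ (2 ℕ.* genus P) ℤ.- + P) (3 ℕ.+ t)) (cong (_* u) (begin
    ι (+ (2 ℕ.* genus P) ℤ.- + P)       ≡⟨ ι-− (+ (2 ℕ.* genus P)) (+ P) ⟩
    ιₙ (2 ℕ.* genus P) + - ιₙ P         ≡⟨ cong (_+ - ιₙ P) (cong ιₙ (twice-genus (2 ℕ.+ t))) ⟩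
    ιₙ ((3 ℕ.+ t) ℕ.* (2 ℕ.+ t)) + - ιₙ P ≡⟨ cong (_+ - ιₙ P) (ιₙ-* (3 ℕ.+ t) (2 ℕ.+ t)) ⟩
    ιₙ (3 ℕ.+ t) * ιₙ (2 ℕ.+ t) + - ιₙ P ≡⟨ cong (_+ - ιₙ P) (cong₂ _*_ (ιₙ-+ 3 t) (ιₙ-+ 2 t)) ⟩
    (ιₙ 3 + τ) * (ιₙ 2 + τ) + - ιₙ P     ∎)))
    where open ≡-Reasoning

  y-value : Fx P r s Ly ≡ k * - ((ιₙ 2 + τ) * u)
  y-value = cong (λ w → k * - w) (trans (ratio-factor (+ (2 ℕ.+ t)) (3 ℕ.+ t)) (cong (_* u) (ιₙ-+ 2 t)))

  count-value : 2 ℕ.* r ℕ.+ s ≡ suc t → ιₙ 2 + (ιₙ 2 * ιₙ r + ιₙ s) ≡ ιₙ 2 + (1ℚ + τ)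
  count-value 2r+s≡1+t = cong (_+_ (ιₙ 2)) (begin
    ιₙ 2 * ιₙ r + ιₙ s       ≡⟨ cong (_+ ιₙ s) (ιₙ-* 2 r) ⟨
    ιₙ (2 ℕ.* r) + ιₙ s      ≡⟨ ιₙ-+ (2 ℕ.* r) s ⟨
    ιₙ (2 ℕ.* r ℕ.+ s)       ≡⟨ cong ιₙ 2r+s≡1+t ⟩
    ιₙ (1 ℕ.+ t)             ≡⟨ ιₙ-+ 1 t ⟩
    1ℚ + τ                   ∎)
    where open ≡-Reasoning

  numerator-value : ι (+ (P ^ 3) ℤ.- + (7 ℕ.* P ^ 2) ℤ.+ + (15 ℕ.* P) ℤ.- + 8)
    ≡ ιₙ P * (ιₙ P * ιₙ P) + - (ιₙ 7 * (ιₙ P * ιₙ P)) + ιₙ 15 * ιₙ P + - ιₙ 8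
  numerator-value = begin
    ι (+ (P ^ 3) ℤ.- + (7 ℕ.* P ^ 2) ℤ.+ + (15 ℕ.* P) ℤ.- + 8)
      ≡⟨ ι-− (+ (P ^ 3) ℤ.- + (7 ℕ.* P ^ 2) ℤ.+ + (15 ℕ.* P)) (+ 8) ⟩
    ι (+ (P ^ 3) ℤ.- + (7 ℕ.* P ^ 2) ℤ.+ + (15 ℕ.* P)) + - ιₙ 8
      ≡⟨ cong (_+ - ιₙ 8) (trans (ι-+ (+ (P ^ 3) ℤ.- + (7 ℕ.* P ^ 2)) (+ (15 ℕ.* P)))
                                   (cong (_+ ιₙ (15 ℕ.* P)) (ι-− (+ (P ^ 3)) (+ (7 ℕ.* P ^ 2))))) ⟩
    ιₙ (P ^ 3) + - ιₙ (7 ℕ.* P ^ 2) + ιₙ (15 ℕ.* P) + - ιₙ 8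
      ≡⟨ cong (_+ - ιₙ 8) (cong₂ _+_ (cong₂ (λ a b → a + - b) (ιₙ-cube P) (trans (ιₙ-* 7 (P ^ 2)) (cong (ιₙ 7 *_) (ιₙ-square P))))
                                      (ιₙ-* 15 P)) ⟩
    ιₙ P * (ιₙ P * ιₙ P) + - (ιₙ 7 * (ιₙ P * ιₙ P)) + ιₙ 15 * ιₙ P + - ιₙ 8 ∎
    where open ≡-Reasoning

  denominator-value : (k * k) * ιₙ (P ^ 2 ℕ.* (P ∸ 3) ^ 2) ≡ 1ℚ
  denominator-value = begin
    (k * k) * ιₙ (P ^ 2 ℕ.* suc t ^ 2)                  ≡⟨ cong (λ n → (k * k) * ιₙ n) (square-product P (suc t)) ⟩
    (k * k) * ιₙ ((P ℕ.* suc t) ℕ.* (P ℕ.* suc t))      ≡⟨ cong ((k * k) *_) (ιₙ-* (P ℕ.* suc t) (P ℕ.* suc t)) ⟩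
    (k * k) * (ιₙ (P ℕ.* suc t) * ιₙ (P ℕ.* suc t))     ≡⟨ regroup k (ιₙ (P ℕ.* suc t)) ⟩
    (k * ιₙ (P ℕ.* suc t)) * (k * ιₙ (P ℕ.* suc t))     ≡⟨ cong₂ _*_ k-inverse k-inverse ⟩
    1ℚ                                                  ∎
    where
    open ≡-Reasoning
    square-product : ∀ a b → (a ℕ.* (a ℕ.* 1)) ℕ.* (b ℕ.* (b ℕ.* 1)) ≡ (a ℕ.* b) ℕ.* (a ℕ.* b)
    square-product = ℕ-Solver.solve-∀
    regroup : ∀ k m → (k * k) * (m * m) ≡ (k * m) * (k * m)
    regroup = Solver.solve-∀ ℚ-ring

Fx-self-intersection : ∀ t r s → 2 ℕ.* r ℕ.+ s ≡ suc t → let p = 4 ℕ.+ t in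
  Fx p r s · Fx p r s ≡ - ratio (+ (p ^ 3) ℤ.- + (7 ℕ.* p ^ 2) ℤ.+ + (15 ℕ.* p) ℤ.- + 8) (p ^ 2 ℕ.* (p ∸ 3) ^ 2)
Fx-self-intersection t r s 2r+s≡1+t = begin
  Fx P r s · Fx P r s
    ≡⟨ canonical-self-intersection (Fx P r s Lx) (Fx P r s Ly) Fx-canonical ⟩
  - (ιₙ P * (Fx P r s Lx * Fx P r s Lx + (ιₙ 2 + (ιₙ 2 * ιₙ r + ιₙ s)) * (Fx P r s Ly * Fx P r s Ly)))
    ≡⟨ self-intersection-value τ k u (ιₙ-+ 4 t) x-value y-value (count-value 2r+s≡1+t) numerator-value
         (ratio-mul (+ 1) (3 ℕ.+ t)) ⟩
  - (ι N * (k * k))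
    ≡⟨ cong -_ (div-by denominator-value (ratio-mul N (ℕ.pred D))) ⟨
  - ratio N D ∎
  where
  open ≡-Reasoning
  open FxCoefficients t r s
  open Fibre P r s
  N : ℤ
  N = + (P ^ 3) ℤ.- + (7 ℕ.* P ^ 2) ℤ.+ + (15 ℕ.* P) ℤ.- + 8
  D : ℕ
  D = P ^ 2 ℕ.* (P ∸ 3) ^ 2

-- 𝒢_x = (1/p) L_x is canonical with y = 0, so 𝒢_x · 𝒢_x = -p (1/p)² = -1/p.
Gx-self-intersection : ∀ d r s → let p = suc d in Gx p r s · Gx p r s ≡ - ratio (+ 1) p
Gx-self-intersection d r s = begin
  Gx p r s · Gx p r s                       ≡⟨ canonical-self-intersection u 0ℚ Gx-canonical ⟩
  - (ιₙ p * (u * u + c * (0ℚ * 0ℚ)))        ≡⟨ regroup (ιₙ p) u c ⟩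
  - ((u * ιₙ p) * u)                        ≡⟨ cong (λ w → - (w * u)) (ratio-mul (+ 1) d) ⟩
  - (1ℚ * u)                                ≡⟨ cong -_ (*-identityˡ u) ⟩
  - u                                       ∎
  where
  open ≡-Reasoning
  p : ℕ
  p = suc d
  open Fibre p r s
  u c : ℚ
  u = ratio (+ 1) p
  c = ιₙ 2 + (ιₙ 2 * ιₙ r + ιₙ s)
  Gx-canonical : Gx p r s ≗ ⟦ canonical u 0ℚ ⟧
  Gx-canonical L         = refl
  Gx-canonical Lx        = refl
  Gx-canonical Ly        = refl
  Gx-canonical Lz        = refl
  Gx-canonical (Lβ _)    = refl
  Gx-canonical (Lα _)    = sym (*-zeroʳ (ιₙ 2))
  Gx-canonical (Lαj _ _) = refl
  regroup : ∀ q u c → - (q * (u * u + c * (0ℚ * 0ℚ))) ≡ - ((u * q) * u)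
  regroup = Solver.solve-∀ ℚ-ring

mainTheorem9 : (p r s : ℕ) → Prime p → 3 < p → 2 ℕ.* r ℕ.+ s ≡ p ∸ 3 →
    ((Fx p r s · Fx p r s) ≡ - ratio (+ (p ^ 3) ℤ.- + (7 ℕ.* p ^ 2) ℤ.+ + (15 ℕ.* p) ℤ.- + 8) (p ^ 2 ℕ.* (p ∸ 3) ^ 2))
    × ((S· Gx p r s) ≡ ratio (+ 1) p)
    × ((S· Gx p r s) ≡ - (Gx p r s · Gx p r s))
mainTheorem9 p@(suc (suc (suc (suc t)))) r s _ _ 2r+s≡p-3 =
  Fx-self-intersection t r s 2r+s≡p-3 , S·Gx , trans S·Gx (sym -Gx·Gx)
  where
  open Fibre p r s
  S·Gx : S· Gx p r s ≡ ratio (+ 1) p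
  S·Gx = S·-picks-Lx (Gx p r s)
  -Gx·Gx : - (Gx p r s · Gx p r s) ≡ ratio (+ 1) p
  -Gx·Gx = trans (cong -_ (Gx-self-intersection (3 ℕ.+ t) r s)) (⁻¹-involutive (ratio (+ 1) p))
mainTheorem9 0 r s _ () _
mainTheorem9 1 r s _ (s≤s ()) _
mainTheorem9 2 r s _ (s≤s (s≤s ())) _
mainTheorem9 3 r s _ (s≤s (s≤s (s≤s ()))) _
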